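{- Let $q=2^m$ with $m\ge 1$, let $E=\mathbb{F}_{q^4}$, and let $\mathcal{P}=\{x\in E \mid x^{q^3+q^2+q+1}=1\}$. Let $\beta\in\mathcal{P}$ and $\alpha\in E$ satisfy $\alpha^{q+1}=\beta^q+\beta^{q^2+q+1}$. Then the equation $X^{q+1}+\alpha X+\beta=0$ has $q+1$ roots in $\mathcal{P}$. -}

module Defs where

open import Level using (Level; _⊔_)
open import Data.Nat using (ℕ; zero; suc)
open import Data.Fin using (Fin)
open import Data.Product using (∃; _×_)
open import Data.List using (List; length)
open import Data.List.Relation.Unary.All using (All)
open import Data.List.Relation.Unary.Any using (Any)
open import Data.List.Relation.Unary.AllPairs using (AllPairs)
open import Relation.Nullary using (¬_)
open import Relation.Binary.PropositionalEquality using (setoid; _≡_)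
open import Function.Bundles using (Inverse)
open import Algebra.Bundles using (CommutativeRing)

IsField : ∀ {c ℓ} → CommutativeRing c ℓ → Set (c ⊔ ℓ)
IsField R = ¬ (1# ≈ 0#) × (∀ x → ¬ (x ≈ 0#) → ∃ λ y → x * y ≈ 1#)
  where open CommutativeRing R

HasCard : ∀ {c ℓ} → CommutativeRing c ℓ → ℕ → Set (c ⊔ ℓ)
HasCard R N = Inverse (CommutativeRing.setoid R) (setoid (Fin N))

pow : ∀ {c ℓ} (R : CommutativeRing c ℓ) → CommutativeRing.Carrier R → ℕ → CommutativeRing.Carrier R
pow R x zero = CommutativeRing.1# R
pow R x (suc n) = CommutativeRing._*_ R x (pow R x n)

HasExactly : ∀ {c ℓ p} (R : CommutativeRing c ℓ) → (CommutativeRing.Carrier R → Set p) → ℕ → Set (c ⊔ ℓ ⊔ p)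
HasExactly R P k = ∃ λ (xs : List Carrier) →
    (length xs ≡ k) × AllPairs (λ x y → ¬ (x ≈ y)) xs × All P xs
    × (∀ x → P x → Any (x ≈_) xs)
  where open CommutativeRing R

module _ {c ℓ} (E : CommutativeRing c ℓ) (q : ℕ) where
  open CommutativeRing E renaming (_+_ to _⊕_; _*_ to _⊗_)
  open import Data.Nat using (_+_; _^_)

  InP : Carrier → Set ℓ
  InP x = pow E x (q ^ 3 + q ^ 2 + q + 1) ≈ 1#

  AlphaBeta : Carrier → Carrier → Set ℓ
  AlphaBeta α β = pow E α (q + 1) ≈ pow E β q ⊕ pow E β (q ^ 2 + q + 1)

  RootInP : Carrier → Carrier → Carrier → Set ℓ
  RootInP α β x = InP x × ((pow E x (q + 1) ⊕ α ⊗ x) ⊕ β ≈ 0#)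

-- Write q = 2^m and σ x = x^q, the Frobenius of E over 𝔽_q; σ⁴ = id, and in characteristic 2 the
-- equation reads x·σx = αx + β. Conjugating it and the hypothesis on α shows that every root has norm
-- x·σx·σ²x·σ³x = 1, i.e. lies in 𝒫, and a root x₀ can be written down using square roots y ↦ y^(q/2).
-- Multiplicative Hilbert 90 gives v ≠ 0 with x₀·σx₀·σv = βv; such a v has trace 0, so by additive
-- Hilbert 90 the equation σz + z = v has q solutions z, each giving a further root x₀(1 + v/z). These
-- q + 1 roots are distinct, and a polynomial of degree q + 1 has no more. Both forms of Hilbert 90 are
-- proved by counting: the fibres of x ↦ x^(q−1) and z ↦ σz + z, and their targets (norm one, trace
-- zero), are root sets of polynomials, hence small.
module Submission where

open import Level using (_⊔_)
open import Algebra.Bundles using (CommutativeRing)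
open import Data.Nat as ℕ using (ℕ; zero; suc; z≤n; s≤s)
import Data.Nat.Properties as ℕ
import Data.Nat.Solver
open import Data.Product using (∃; _×_; _,_; proj₁; proj₂)
open import Data.Fin as Fin using (Fin)
import Data.Fin.Properties as Finₚ
open import Function.Bundles using (Inverse; mk↔ₛ′)
import Function.Construct.Composition as Composition
open import Function using (id)
open import Data.Empty using (⊥-elim)
open import Data.List using (List; []; _∷_; length; filter; tabulate; map)
open import Data.List.Properties using (length-tabulate; length-map)
open import Data.List.Relation.Unary.Any as Any using (here; there)
open import Data.List.Relation.Unary.All as All using (All; []; _∷_)
import Data.List.Relation.Unary.All.Properties as Allₚ
open import Data.List.Relation.Unary.AllPairs using ([]; _∷_)
open import Relation.Nullary using (¬_; ¬?; Dec; yes; no)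
open import Relation.Nullary.Decidable as Dec using (decidable-stable)
open import Relation.Unary using (Pred; Decidable)
open import Relation.Unary.Properties using (∁?)
open import Relation.Binary.Bundles using (DecSetoid)
open import Relation.Binary.PropositionalEquality as ≡ using (_≡_)
import Relation.Binary.Reasoning.Setoid

open import Defs

module RingProperties {c ℓ} (R : CommutativeRing c ℓ) where
  open CommutativeRing R
  open import Algebra.Properties.CommutativeSemiring.Exp commutativeSemiring public

  pow≡^ : ∀ x n → pow R x n ≡ x ^ n
  pow≡^ x zero    = ≡.refl
  pow≡^ x (suc n) = ≡.cong (x *_) (pow≡^ x n)

  1^n≈1 : ∀ n → 1# ^ n ≈ 1#
  1^n≈1 zero    = refl
  1^n≈1 (suc n) = trans (*-identityˡ _) (1^n≈1 n)

module FieldProperties {c ℓ} (F : CommutativeRing c ℓ) (isField : IsField F) where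
  open CommutativeRing F
  open import Algebra.Properties.Ring ring using ([y-z]x≈yx-zx)
  open import Algebra.Properties.AbelianGroup +-abelianGroup using (x∙y⁻¹≈ε⇒x≈y; x≈y⇒x∙y⁻¹≈ε)
  open import Algebra.Solver.Ring.NaturalCoefficients.Default commutativeSemiring
  open import Relation.Binary.Reasoning.Setoid setoid
  open RingProperties F

  1≉0 : 1# ≉ 0#
  1≉0 = proj₁ isField

  inverse : ∀ {x} → x ≉ 0# → ∃ λ y → x * y ≈ 1#
  inverse = proj₂ isField _

  x*y≈1⇒y≉0 : ∀ {x y} → x * y ≈ 1# → y ≉ 0#
  x*y≈1⇒y≉0 {x} xy≈1 y≈0 = 1≉0 (trans (sym xy≈1) (trans (*-congˡ y≈0) (zeroʳ x)))

  x*y≈0⇒y≈0 : ∀ {x y} → x ≉ 0# → x * y ≈ 0# → y ≈ 0#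
  x*y≈0⇒y≈0 {x} {y} x≉0 xy≈0 with inverse x≉0
  ... | x⁻¹ , xx⁻¹≈1 = begin
    y                ≈⟨ *-identityʳ y ⟨
    y * 1#           ≈⟨ *-congˡ xx⁻¹≈1 ⟨
    y * (x * x⁻¹)    ≈⟨ solve 3 (λ x x⁻¹ y → y :* (x :* x⁻¹) := x⁻¹ :* (x :* y)) refl x x⁻¹ y ⟩
    x⁻¹ * (x * y)    ≈⟨ *-congˡ xy≈0 ⟩
    x⁻¹ * 0#         ≈⟨ zeroʳ x⁻¹ ⟩
    0#               ∎

  x*z≈y*z⇒[x-y]*z≈0 : ∀ {x y z} → x * z ≈ y * z → (x - y) * z ≈ 0#
  x*z≈y*z⇒[x-y]*z≈0 {x} {y} {z} xz≈yz = trans ([y-z]x≈yx-zx z x y) (x≈y⇒x∙y⁻¹≈ε xz≈yz)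

  *-cancelʳ-nonzero : ∀ {x y z} → z ≉ 0# → x * z ≈ y * z → x ≈ y
  *-cancelʳ-nonzero {x} {y} {z} z≉0 xz≈yz =
    x∙y⁻¹≈ε⇒x≈y x y (x*y≈0⇒y≈0 z≉0 (trans (*-comm z (x - y)) (x*z≈y*z⇒[x-y]*z≈0 xz≈yz)))

  *-cancelˡ-nonzero : ∀ {x y z} → x ≉ 0# → x * y ≈ x * z → y ≈ z
  *-cancelˡ-nonzero {x} {y} {z} x≉0 xy≈xz =
    *-cancelʳ-nonzero x≉0 (trans (*-comm y x) (trans xy≈xz (*-comm x z)))

  *-nonzero : ∀ {x y} → x ≉ 0# → y ≉ 0# → x * y ≉ 0#
  *-nonzero x≉0 y≉0 xy≈0 = y≉0 (x*y≈0⇒y≈0 x≉0 xy≈0)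

  ^-nonzero : ∀ {x} n → x ≉ 0# → x ^ n ≉ 0#
  ^-nonzero zero    _   = 1≉0
  ^-nonzero (suc n) x≉0 = *-nonzero x≉0 (^-nonzero n x≉0)

module PolynomialFunctions {c ℓ} (F : CommutativeRing c ℓ) (isField : IsField F) where
  open CommutativeRing F
  open RingProperties F
  open FieldProperties F isField
  open import Algebra.Properties.AbelianGroup +-abelianGroup using (x∙y⁻¹≈ε⇒x≈y)
  open import Algebra.Solver.Ring.NaturalCoefficients.Default commutativeSemiring
  open import Data.List.Relation.Unary.Unique.Setoid setoid using (Unique)
  open import Relation.Binary.Reasoning.Setoid setoid

  data Poly : ℕ → (Carrier → Carrier) → Set (c ⊔ ℓ) where
    constant : ∀ {f} a → (∀ y → f y ≈ a) → Poly 0 f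
    horner   : ∀ {d f} a h → Poly d h → (∀ y → f y ≈ a + y * h y) → Poly (suc d) f

  data Monic : ℕ → (Carrier → Carrier) → Set (c ⊔ ℓ) where
    one    : ∀ {f} → (∀ y → f y ≈ 1#) → Monic 0 f
    horner : ∀ {d f} a h → Monic d h → (∀ y → f y ≈ a + y * h y) → Monic (suc d) f

  Monic-resp : ∀ {d f g} → (∀ y → g y ≈ f y) → Monic d f → Monic d g
  Monic-resp g≈f (one f≈1)           = one (λ y → trans (g≈f y) (f≈1 y))
  Monic-resp g≈f (horner a h M f≈ah) = horner a h M (λ y → trans (g≈f y) (f≈ah y))

  poly-constant : ∀ a → Poly 0 (λ _ → a)
  poly-constant a = constant a (λ _ → refl)

  poly-id : Poly 1 (λ y → y)
  poly-id = horner 0# (λ _ → 1#) (poly-constant 1#) (λ y → solve 1 (λ y → y := con 0 :+ y :* con 1) refl y)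

  poly-≤ : ∀ {d e f} → d ℕ.≤ e → Poly d f → Poly e f
  poly-≤ d≤e = go (ℕ.≤⇒≤′ d≤e)
    where
    poly-suc : ∀ {d f} → Poly d f → Poly (suc d) f
    poly-suc (constant a f≈a) =
      horner a (λ _ → 0#) (poly-constant 0#) (λ y → trans (f≈a y) (solve 2 (λ a y → a := a :+ y :* con 0) refl a y))
    poly-suc (horner a h P f≈ah) = horner a h (poly-suc P) f≈ah

    go : ∀ {d e f} → d ℕ.≤′ e → Poly d f → Poly e f
    go ℕ.≤′-refl        P = P
    go (ℕ.≤′-step d≤′e) P = poly-suc (go d≤′e P)

  poly-+ : ∀ {d f g} → Poly d f → Poly d g → Poly d (λ y → f y + g y)
  poly-+ (constant a f≈a) (constant b g≈b) = constant (a + b) (λ y → +-cong (f≈a y) (g≈b y))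
  poly-+ (horner a h P f≈ah) (horner b k Q g≈bk) = horner (a + b) (λ y → h y + k y) (poly-+ P Q)
    (λ y → trans (+-cong (f≈ah y) (g≈bk y))
      (solve 5 (λ a b y h k → a :+ y :* h :+ (b :+ y :* k) := a :+ b :+ y :* (h :+ k)) refl a b y (h y) (k y)))

  monic⇒poly : ∀ {d f} → Monic d f → Poly d f
  monic⇒poly (one f≈1)           = constant 1# f≈1
  monic⇒poly (horner a h M f≈ah) = horner a h (monic⇒poly M) f≈ah

  monic-^ : ∀ n → Monic n (_^ n)
  monic-^ zero    = one (λ _ → refl)
  monic-^ (suc n) = horner 0# (_^ n) (monic-^ n) (λ y → sym (+-identityˡ _))

  private
    monic-+-poly : ∀ {d f g} → Monic (suc d) f → Poly d g → Monic (suc d) (λ y → f y + g y)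
    monic-+-poly (horner a h M f≈ah) (constant b g≈b) = horner (a + b) h M
      (λ y → trans (+-cong (f≈ah y) (g≈b y))
        (solve 4 (λ a b y h → a :+ y :* h :+ b := a :+ b :+ y :* h) refl a b y (h y)))
    monic-+-poly (horner a h M f≈ah) (horner b k P g≈bk) = horner (a + b) (λ y → h y + k y) (monic-+-poly M P)
      (λ y → trans (+-cong (f≈ah y) (g≈bk y))
        (solve 5 (λ a b y h k → a :+ y :* h :+ (b :+ y :* k) := a :+ b :+ y :* (h :+ k)) refl a b y (h y) (k y)))

  monic-+ : ∀ {d e f g} → Monic d f → Poly e g → e ℕ.< d → Monic d (λ y → f y + g y)
  monic-+ M P (s≤s e≤d) = monic-+-poly M (poly-≤ e≤d P)

  -- f(y) − f(r) = (y − r)·g(y), with both sides moved so that no subtraction occurs.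
  monic-divide : ∀ {d f} → Monic (suc d) f → ∀ r →
                 ∃ λ g → Monic d g × (∀ y → f y + r * g y ≈ y * g y + f r)
  monic-divide {f = f} (horner a h (one h≈1) f≈ah) r = (λ _ → 1#) , one (λ _ → refl) , λ y → begin
    f y + r * 1#            ≈⟨ +-congʳ (f≈ah y) ⟩
    a + y * h y + r * 1#    ≈⟨ +-congʳ (+-congˡ (*-congˡ (h≈1 y))) ⟩
    a + y * 1# + r * 1#     ≈⟨ solve 3 (λ a y r → a :+ y :* con 1 :+ r :* con 1 := y :* con 1 :+ (a :+ r :* con 1)) refl a y r ⟩
    y * 1# + (a + r * 1#)   ≈⟨ +-congˡ (+-congˡ (*-congˡ (h≈1 r))) ⟨
    y * 1# + (a + r * h r)  ≈⟨ +-congˡ (f≈ah r) ⟨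
    y * 1# + f r            ∎
  monic-divide {f = f} (horner a h M@(horner _ _ _ _) f≈ah) r with monic-divide M r
  ... | g , Mg , h-div = (λ y → h r + y * g y) , horner (h r) g Mg (λ _ → refl) , λ y → begin
    f y + r * (h r + y * g y)
      ≈⟨ +-congʳ (f≈ah y) ⟩
    a + y * h y + r * (h r + y * g y)
      ≈⟨ solve 6 (λ a y r h hr g → a :+ y :* h :+ r :* (hr :+ y :* g) := a :+ r :* hr :+ y :* (h :+ r :* g)) refl a y r (h y) (h r) (g y) ⟩
    a + r * h r + y * (h y + r * g y)
      ≈⟨ +-congˡ (*-congˡ (h-div y)) ⟩
    a + r * h r + y * (y * g y + h r)
      ≈⟨ solve 5 (λ a y r hr g → a :+ r :* hr :+ y :* (y :* g :+ hr) := y :* (hr :+ y :* g) :+ (a :+ r :* hr)) refl a y r (h r) (g y) ⟩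
    y * (h r + y * g y) + (a + r * h r)
      ≈⟨ +-congˡ (f≈ah r) ⟨
    y * (h r + y * g y) + f r ∎

  monic-roots : ∀ {d f xs} → Monic d f → Unique xs → All (λ x → f x ≈ 0#) xs → length xs ℕ.≤ d
  monic-roots _ [] [] = z≤n
  monic-roots (one f≈1) (_ ∷ _) (fx≈0 ∷ _) = ⊥-elim (1≉0 (trans (sym (f≈1 _)) fx≈0))
  monic-roots {f = f} {x ∷ _} M@(horner _ _ _ _) (x≉xs ∷ xs!) (fx≈0 ∷ fxs≈0) with monic-divide M x
  ... | g , Mg , f-div = s≤s (monic-roots Mg xs! (All.zipWith g≈0 (x≉xs , fxs≈0)))
    where
    g≈0 : ∀ {z} → x ≉ z × f z ≈ 0# → g z ≈ 0#
    g≈0 {z} (x≉z , fz≈0) = x*y≈0⇒y≈0 (λ z-x≈0 → x≉z (sym (x∙y⁻¹≈ε⇒x≈y z x z-x≈0)))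
      (x*z≈y*z⇒[x-y]*z≈0 (begin
        z * g z          ≈⟨ +-identityʳ _ ⟨
        z * g z + 0#     ≈⟨ +-congˡ fx≈0 ⟨
        z * g z + f x    ≈⟨ f-div z ⟨
        f z + x * g z    ≈⟨ +-congʳ fz≈0 ⟩
        0# + x * g z     ≈⟨ +-identityˡ _ ⟩
        x * g z          ∎))

CharacteristicTwo : ∀ {c ℓ} → CommutativeRing c ℓ → Set ℓ
CharacteristicTwo R = 1# + 1# ≈ 0#
  where open CommutativeRing R

module CharacteristicTwoProperties {c ℓ} (R : CommutativeRing c ℓ) (char2 : CharacteristicTwo R) where
  open CommutativeRing R
  open RingProperties R
  open import Algebra.Solver.Ring.NaturalCoefficients.Default commutativeSemiring
  open import Relation.Binary.Reasoning.Setoid setoid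

  x+x≈0 : ∀ x → x + x ≈ 0#
  x+x≈0 x = begin
    x + x          ≈⟨ solve 1 (λ x → x :+ x := x :* (con 1 :+ con 1)) refl x ⟩
    x * (1# + 1#)  ≈⟨ *-congˡ char2 ⟩
    x * 0#         ≈⟨ zeroʳ x ⟩
    0#             ∎

  x+[y+y]≈x : ∀ x y → x + (y + y) ≈ x
  x+[y+y]≈x x y = trans (+-congˡ (x+x≈0 y)) (+-identityʳ x)

  x≈y⇒x+y≈0 : ∀ {x y} → x ≈ y → x + y ≈ 0#
  x≈y⇒x+y≈0 {y = y} x≈y = trans (+-congʳ x≈y) (x+x≈0 y)

  x+y≈0⇒x≈y : ∀ {x y} → x + y ≈ 0# → x ≈ y
  x+y≈0⇒x≈y {x} {y} x+y≈0 = begin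
    x              ≈⟨ x+[y+y]≈x x y ⟨
    x + (y + y)    ≈⟨ +-assoc x y y ⟨
    x + y + y      ≈⟨ +-congʳ x+y≈0 ⟩
    0# + y         ≈⟨ +-identityˡ y ⟩
    y              ∎

  x+y≈z⇒x+z≈y : ∀ {x y z} → x + y ≈ z → x + z ≈ y
  x+y≈z⇒x+z≈y {x} {y} {z} x+y≈z = begin
    x + z          ≈⟨ +-congˡ x+y≈z ⟨
    x + (x + y)    ≈⟨ +-assoc x x y ⟨
    x + x + y      ≈⟨ +-congʳ (x+x≈0 x) ⟩
    0# + y         ≈⟨ +-identityˡ y ⟩
    y              ∎

  frobenius : ∀ k x y → (x + y) ^ (2 ℕ.^ k) ≈ x ^ (2 ℕ.^ k) + y ^ (2 ℕ.^ k)
  frobenius zero x y = solve 2 (λ x y → (x :+ y) :* con 1 := x :* con 1 :+ y :* con 1) refl x y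
  frobenius (suc k) x y = begin
    (x + y) ^ (2 ℕ.* 2 ℕ.^ k)                ≈⟨ ^-assocʳ (x + y) 2 (2 ℕ.^ k) ⟨
    ((x + y) ^ 2) ^ (2 ℕ.^ k)                ≈⟨ ^-congˡ (2 ℕ.^ k) square-+ ⟩
    (x ^ 2 + y ^ 2) ^ (2 ℕ.^ k)              ≈⟨ frobenius k (x ^ 2) (y ^ 2) ⟩
    (x ^ 2) ^ (2 ℕ.^ k) + (y ^ 2) ^ (2 ℕ.^ k) ≈⟨ +-cong (^-assocʳ x 2 (2 ℕ.^ k)) (^-assocʳ y 2 (2 ℕ.^ k)) ⟩
    x ^ (2 ℕ.* 2 ℕ.^ k) + y ^ (2 ℕ.* 2 ℕ.^ k) ∎
    where
    square-+ : (x + y) ^ 2 ≈ x ^ 2 + y ^ 2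
    square-+ = begin
      (x + y) ^ 2
        ≈⟨ solve 2 (λ x y → (x :+ y) :* ((x :+ y) :* con 1) := x :* (x :* con 1) :+ y :* (y :* con 1) :+ (x :* y :+ x :* y)) refl x y ⟩
      x ^ 2 + y ^ 2 + (x * y + x * y)
        ≈⟨ x+[y+y]≈x _ _ ⟩
      x ^ 2 + y ^ 2 ∎

module Counting {a ℓ} (S : DecSetoid a ℓ) where
  open DecSetoid S renaming (Carrier to A)
  open import Data.List.Relation.Unary.Unique.Setoid setoid using (Unique)
  open import Data.List.Membership.Setoid setoid using (_∈_)
  import Data.List.Relation.Unary.Unique.Setoid.Properties as Unique
  open import Data.List.Membership.Setoid.Properties using (∈-filter⁺)
  open import Data.List.Properties using (filter-notAll)

  length-filter-split : ∀ {p} {P : Pred A p} (P? : Decidable P) xs →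
                        length xs ≡ length (filter P? xs) ℕ.+ length (filter (∁? P?) xs)
  length-filter-split P? [] = ≡.refl
  length-filter-split P? (x ∷ xs) with P? x
  ... | yes _ = ≡.cong suc (length-filter-split P? xs)
  ... | no  _ = ≡.trans (≡.cong suc (length-filter-split P? xs)) (≡.sym (ℕ.+-suc _ _))

  FibresBoundedBy : (A → A) → ℕ → Set (a ⊔ ℓ)
  FibresBoundedBy φ k = ∀ b {ys} → Unique ys → All (λ y → φ y ≈ b) ys → length ys ℕ.≤ k

  fibre : (A → A) → A → List A → List A
  fibre φ b = filter (λ x → φ x ≟ b)

  private
    outside-fibre : ∀ (φ : A → A) b {bs} xs → All (λ x → φ x ∈ b ∷ bs) xs →
                    All (λ x → φ x ∈ bs) (filter (∁? (λ x → φ x ≟ b)) xs)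
    outside-fibre φ b {bs} xs φxs∈b∷bs =
      All.zipWith drop-b (Allₚ.all-filter (∁? (λ x → φ x ≟ b)) xs , Allₚ.filter⁺ (∁? (λ x → φ x ≟ b)) φxs∈b∷bs)
      where
      drop-b : ∀ {x} → ¬ (φ x ≈ b) × φ x ∈ b ∷ bs → φ x ∈ bs
      drop-b (φx≉b , here φx≈b)  = ⊥-elim (φx≉b φx≈b)
      drop-b (_    , there φx∈bs) = φx∈bs

  fibres-bound : ∀ {φ k} → FibresBoundedBy φ k → ∀ {xs} bs → Unique xs →
                 All (λ x → φ x ∈ bs) xs → length xs ℕ.≤ length bs ℕ.* k
  fibres-bound _ {[]} _ _ _ = z≤n
  fibres-bound _ {_ ∷ _} [] _ (() ∷ _)
  fibres-bound {φ} {k} bounded {xs} (b ∷ bs) xs! φxs∈ = begin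
    length xs
      ≡⟨ length-filter-split (λ x → φ x ≟ b) xs ⟩
    length (fibre φ b xs) ℕ.+ length (filter (∁? (λ x → φ x ≟ b)) xs)
      ≤⟨ ℕ.+-mono-≤ (bounded b (Unique.filter⁺ setoid _ xs!) (Allₚ.all-filter _ xs))
                    (fibres-bound bounded bs (Unique.filter⁺ setoid _ xs!) (outside-fibre φ b xs φxs∈)) ⟩
    k ℕ.+ length bs ℕ.* k                                       ∎
    where open ℕ.≤-Reasoning

  fibre-large : ∀ {φ k} → FibresBoundedBy φ k → ∀ {xs bs} → Unique xs →
                All (λ x → φ x ∈ bs) xs → length bs ℕ.* k ℕ.≤ length xs →
                ∀ {b} → b ∈ bs → k ℕ.≤ length (fibre φ b xs)
  fibre-large {φ} {k} bounded {xs} {bs} xs! φxs∈bs bs*k≤xs {b} b∈bs =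
    ℕ.+-cancelʳ-≤ (length others ℕ.* k) k (length (fibre φ b xs)) (begin
      suc (length others) ℕ.* k                       ≤⟨ ℕ.*-monoˡ-≤ k others<bs ⟩
      length bs ℕ.* k                                 ≤⟨ bs*k≤xs ⟩
      length xs                                       ≡⟨ length-filter-split (λ x → φ x ≟ b) xs ⟩
      length (fibre φ b xs) ℕ.+ length rest           ≤⟨ ℕ.+-monoʳ-≤ (length (fibre φ b xs)) rest-bound ⟩
      length (fibre φ b xs) ℕ.+ length others ℕ.* k  ∎)
    where
    open ℕ.≤-Reasoning
    others = filter (λ y → ¬? (y ≟ b)) bs
    rest = filter (∁? (λ x → φ x ≟ b)) xs

    others<bs : length others ℕ.< length bs
    others<bs = filter-notAll (λ y → ¬? (y ≟ b)) bs (Any.map (λ b≈y y≉b → y≉b (sym b≈y)) b∈bs)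

    rest-bound : length rest ℕ.≤ length others ℕ.* k
    rest-bound = fibres-bound bounded others (Unique.filter⁺ setoid _ xs!)
      (All.zipWith (λ (φx≉b , φx∈bs) → ∈-filter⁺ setoid (λ y → ¬? (y ≟ b)) (λ x≈y x≉b y≈b → x≉b (trans x≈y y≈b)) φx∈bs φx≉b)
                   (Allₚ.all-filter (∁? (λ x → φ x ≟ b)) xs , Allₚ.filter⁺ (∁? (λ x → φ x ≟ b)) φxs∈bs))

  preimage-by-counting : ∀ {φ k} → FibresBoundedBy φ k → 1 ℕ.≤ k → ∀ {p} {P : Pred A p} {xs bs} →
                         All P xs → Unique xs → All (λ x → φ x ∈ bs) xs →
                         length bs ℕ.* k ℕ.≤ length xs → ∀ {b} → b ∈ bs → ∃ λ x → P x × φ x ≈ b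
  preimage-by-counting {φ} {k} bounded 1≤k {P = P} {xs = xs} Pxs xs! φxs∈bs bs*k≤xs {b} b∈bs =
    witness (ℕ.≤-trans 1≤k (fibre-large bounded xs! φxs∈bs bs*k≤xs b∈bs))
            (All.zipWith id (Allₚ.filter⁺ (λ x → φ x ≟ b) Pxs , Allₚ.all-filter (λ x → φ x ≟ b) xs))
    where
    witness : ∀ {ys} → 1 ℕ.≤ length ys → All (λ x → P x × φ x ≈ b) ys → ∃ λ x → P x × φ x ≈ b
    witness {y ∷ _} _ (Py ∷ _) = y , Py

-- Fin.cast rather than subst: the equation is irrelevant, so it is never normalised.
HasCard-cast : ∀ {c ℓ} {R : CommutativeRing c ℓ} {m n} → m ≡ n → HasCard R m → HasCard R n
HasCard-cast m≡n card = Composition.inverse card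
  (mk↔ₛ′ (Fin.cast m≡n) (Fin.cast (≡.sym m≡n)) (Finₚ.cast-involutive m≡n (≡.sym m≡n)) (Finₚ.cast-involutive (≡.sym m≡n) m≡n))

module FiniteField {c ℓ} (F : CommutativeRing c ℓ) (isField : IsField F) {n} (card : HasCard F (suc n)) where
  open CommutativeRing F
  open RingProperties F
  open FieldProperties F isField
  open Inverse card using (to; from; to-cong; from-cong; strictlyInverseˡ; strictlyInverseʳ)
  open import Algebra.Properties.CommutativeMonoid.Sum *-commutativeMonoid
    using () renaming (sum to ∏; sum-permute to ∏-permute; ∑-distrib-+ to ∏-distrib-*; sum-replicate to ∏-replicate; sum-cong-≋ to ∏-cong)
  open import Data.List.Relation.Unary.Unique.Setoid setoid using (Unique)
  open import Data.List.Membership.Setoid setoid using (_∈_)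
  open import Data.List.Membership.Setoid.Properties using (∈-tabulate⁺; ∈-resp-≈)
  open import Data.Fin.Permutation using (Permutation; permutation)
  open import Algebra.Properties.Ring ring using (-1*x≈-x; -‿involutive)
  import Data.List.Relation.Unary.Unique.Setoid.Properties as Unique
  module ≈-Reasoning = Relation.Binary.Reasoning.Setoid setoid

  to-injective : ∀ {x y} → to x ≡ to y → x ≈ y
  to-injective {x} {y} tx≡ty = trans (sym (strictlyInverseʳ x)) (trans (from-cong tx≡ty) (strictlyInverseʳ y))

  infix 4 _≟_
  _≟_ : ∀ x y → Dec (x ≈ y)
  x ≟ y = Dec.map′ to-injective to-cong (to x Fin.≟ to y)

  decSetoid : DecSetoid c ℓ
  decSetoid = record { isDecEquivalence = record { isEquivalence = isEquivalence ; _≟_ = _≟_ } }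

  elements : List Carrier
  elements = tabulate from

  elements-unique : Unique elements
  elements-unique = Unique.tabulate⁺ setoid (λ {i} {j} fi≈fj → ≡.trans (≡.sym (strictlyInverseˡ i)) (≡.trans (to-cong fi≈fj) (strictlyInverseˡ j)))

  ∈-elements : ∀ x → x ∈ elements
  ∈-elements x = ∈-resp-≈ setoid (strictlyInverseʳ x) (∈-tabulate⁺ setoid {f = from} (to x))

  length-elements : length elements ≡ suc n
  length-elements = length-tabulate from

  nonzeroElements : List Carrier
  nonzeroElements = filter (λ x → ¬? (x ≟ 0#)) elements

  n≤length-nonzeroElements : n ℕ.≤ length nonzeroElements
  n≤length-nonzeroElements = ℕ.+-cancelˡ-≤ 1 n (length nonzeroElements) (begin
    suc n
      ≡⟨ length-elements ⟨
    length elements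
      ≡⟨ Counting.length-filter-split decSetoid (λ x → x ≟ 0#) elements ⟩
    length zeros ℕ.+ length nonzeroElements
      ≤⟨ ℕ.+-monoˡ-≤ _ (at-most-one-zero zeros (Unique.filter⁺ setoid (λ x → x ≟ 0#) elements-unique) (Allₚ.all-filter (λ x → x ≟ 0#) elements)) ⟩
    1 ℕ.+ length nonzeroElements ∎)
    where
    open ℕ.≤-Reasoning
    zeros = filter (λ x → x ≟ 0#) elements
    at-most-one-zero : ∀ xs → Unique xs → All (_≈ 0#) xs → length xs ℕ.≤ 1
    at-most-one-zero []               _                 _               = z≤n
    at-most-one-zero (_ ∷ [])         _                 _               = s≤s z≤n
    at-most-one-zero (_ ∷ _ ∷ _) ((x≉y ∷ _) ∷ _) (x≈0 ∷ y≈0 ∷ _) = ⊥-elim (x≉y (trans x≈0 (sym y≈0)))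

  private
    unit : Fin n → Carrier
    unit i = from (Fin.punchIn (to 0#) i)

    unit-nonzero : ∀ i → unit i ≉ 0#
    unit-nonzero i unit≈0 = Finₚ.punchInᵢ≢i (to 0#) i (≡.trans (≡.sym (strictlyInverseˡ _)) (to-cong unit≈0))

    index : ∀ {y} → y ≉ 0# → Fin n
    index y≉0 = Fin.punchOut (λ to0≡toy → y≉0 (sym (to-injective to0≡toy)))

    unit-index : ∀ {y} (y≉0 : y ≉ 0#) → unit (index y≉0) ≈ y
    unit-index y≉0 = trans (from-cong (Finₚ.punchIn-punchOut _)) (strictlyInverseʳ _)

    index-unique : ∀ {i y} (y≉0 : y ≉ 0#) → unit i ≈ y → index y≉0 ≡ i
    index-unique {i} y≉0 unit≈y =
      ≡.trans (Finₚ.punchOut-cong (to 0#) (≡.trans (≡.sym (to-cong unit≈y)) (strictlyInverseˡ _))) (Finₚ.punchOut-punchIn (to 0#))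

    times : ∀ {a} → a ≉ 0# → Fin n → Fin n
    times a≉0 i = index (*-nonzero a≉0 (unit-nonzero i))

    times-inverse : ∀ {a b} (a≉0 : a ≉ 0#) (b≉0 : b ≉ 0#) → a * b ≈ 1# → ∀ i → times a≉0 (times b≉0 i) ≡ i
    times-inverse {a} {b} a≉0 b≉0 ab≈1 i = index-unique (*-nonzero a≉0 (unit-nonzero (times b≉0 i))) (begin
      unit i                          ≈⟨ *-identityˡ _ ⟨
      1# * unit i                     ≈⟨ *-congʳ ab≈1 ⟨
      a * b * unit i                  ≈⟨ *-assoc a b (unit i) ⟩
      a * (b * unit i)                ≈⟨ *-congˡ (unit-index (*-nonzero b≉0 (unit-nonzero i))) ⟨
      a * unit (times b≉0 i)          ∎)
      where open ≈-Reasoning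

    ∏-nonzero : ∀ {m} (f : Fin m → Carrier) → (∀ i → f i ≉ 0#) → ∏ f ≉ 0#
    ∏-nonzero {zero}  f f≉0 = 1≉0
    ∏-nonzero {suc m} f f≉0 = *-nonzero (f≉0 Fin.zero) (∏-nonzero (λ i → f (Fin.suc i)) (λ i → f≉0 (Fin.suc i)))

  -- Multiplication by x permutes the nonzero elements, so their product P satisfies P = xⁿ P.
  fermat-nonzero : ∀ {x} → x ≉ 0# → x ^ n ≈ 1#
  fermat-nonzero {x} x≉0 = sym (*-cancelʳ-nonzero (∏-nonzero unit unit-nonzero) (begin
    1# * ∏ unit                   ≈⟨ *-identityˡ _ ⟩
    ∏ unit                        ≈⟨ ∏-permute unit π ⟩
    ∏ {n} (λ i → unit (times x≉0 i)) ≈⟨ ∏-cong {n} (λ i → unit-index (*-nonzero x≉0 (unit-nonzero i))) ⟩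
    ∏ {n} (λ i → x * unit i)      ≈⟨ ∏-distrib-* (λ _ → x) unit ⟩
    ∏ {n} (λ _ → x) * ∏ unit      ≈⟨ *-congʳ (∏-replicate n) ⟩
    x ^ n * ∏ unit                ∎))
    where
    open ≈-Reasoning
    x⁻¹ = proj₁ (inverse x≉0)
    xx⁻¹≈1 = proj₂ (inverse x≉0)
    x⁻¹≉0 = x*y≈1⇒y≉0 xx⁻¹≈1
    π : Permutation n n
    π = permutation (times x≉0) (times x⁻¹≉0) (times-inverse x≉0 x⁻¹≉0 xx⁻¹≈1)
                    (times-inverse x⁻¹≉0 x≉0 (trans (*-comm x⁻¹ x) xx⁻¹≈1))

  fermat : ∀ x → x ^ suc n ≈ x
  fermat x with x ≟ 0#
  ... | yes x≈0 = trans (*-congʳ x≈0) (trans (zeroˡ _) (sym x≈0))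
  ... | no  x≉0 = trans (*-congˡ (fermat-nonzero x≉0)) (*-identityʳ x)

  characteristic-two : ∀ m → suc n ≡ 2 ℕ.* m → CharacteristicTwo F
  characteristic-two m |F|≡2m = begin
    1# + 1#     ≈⟨ +-congʳ 1≈-1 ⟩
    - 1# + 1#   ≈⟨ -‿inverseˡ 1# ⟩
    0#          ∎
    where
    open ≈-Reasoning
    [-1]²≈1 : (- 1#) ^ 2 ≈ 1#
    [-1]²≈1 = trans (*-congˡ (*-identityʳ _)) (trans (-1*x≈-x (- 1#)) (-‿involutive 1#))
    1≈-1 : 1# ≈ - 1#
    1≈-1 = begin
      1#                     ≈⟨ 1^n≈1 m ⟨
      1# ^ m                 ≈⟨ ^-congˡ m [-1]²≈1 ⟨
      ((- 1#) ^ 2) ^ m       ≈⟨ ^-assocʳ (- 1#) 2 m ⟩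
      (- 1#) ^ (2 ℕ.* m)     ≡⟨ ≡.cong ((- 1#) ^_) |F|≡2m ⟨
      (- 1#) ^ suc n         ≈⟨ fermat (- 1#) ⟩
      - 1#                   ∎

  -- The inverse made total by the junk value 0⁻¹ = 0.
  _⁻¹ : Carrier → Carrier
  x ⁻¹ with x ≟ 0#
  ... | yes _   = 0#
  ... | no  x≉0 = proj₁ (inverse x≉0)

  x*x⁻¹≈1 : ∀ {x} → x ≉ 0# → x * x ⁻¹ ≈ 1#
  x*x⁻¹≈1 {x} x≉0 with x ≟ 0#
  ... | yes x≈0  = ⊥-elim (x≉0 x≈0)
  ... | no  x≉0′ = proj₂ (inverse x≉0′)

  ⁻¹-injective : ∀ {x y} → x ⁻¹ ≈ y ⁻¹ → x ≈ y
  ⁻¹-injective {x} {y} x⁻¹≈y⁻¹ with x ≟ 0# | y ≟ 0#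
  ... | yes x≈0 | yes y≈0 = trans x≈0 (sym y≈0)
  ... | yes _   | no  y≉0 = ⊥-elim (x*y≈1⇒y≉0 (proj₂ (inverse y≉0)) (sym x⁻¹≈y⁻¹))
  ... | no  x≉0 | yes _   = ⊥-elim (x*y≈1⇒y≉0 (proj₂ (inverse x≉0)) x⁻¹≈y⁻¹)
  ... | no  x≉0 | no  y≉0 = *-cancelʳ-nonzero (x*y≈1⇒y≉0 (proj₂ (inverse x≉0)))
    (trans (proj₂ (inverse x≉0)) (trans (sym (proj₂ (inverse y≉0))) (*-congˡ (sym x⁻¹≈y⁻¹))))

[1+p]^4≡1+p*Σ[1+p]^i : ∀ p → suc p ℕ.^ 4 ≡ suc (p ℕ.* (suc p ℕ.^ 3 ℕ.+ suc p ℕ.^ 2 ℕ.+ suc p ℕ.+ 1))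
[1+p]^4≡1+p*Σ[1+p]^i = solve 1 (λ p → (con 1 :+ p) :^ 4 := con 1 :+ p :* ((con 1 :+ p) :^ 3 :+ (con 1 :+ p) :^ 2 :+ (con 1 :+ p) :+ con 1)) ≡.refl
  where open Data.Nat.Solver.+-*-Solver

module QuarticExtension {c ℓ} (E : CommutativeRing c ℓ) (isField : IsField E)
                        (k : ℕ) (card : HasCard E ((2 ℕ.^ suc k) ℕ.^ 4)) where
  open CommutativeRing E
  open RingProperties E
  open FieldProperties E isField
  open PolynomialFunctions E isField
  open import Algebra.Solver.Ring.NaturalCoefficients.Default commutativeSemiring
  open import Relation.Binary.Reasoning.Setoid setoid

  q half p K : ℕ
  q = 2 ℕ.^ suc k
  half = 2 ℕ.^ k
  p = ℕ.pred q
  K = q ℕ.^ 3 ℕ.+ q ℕ.^ 2 ℕ.+ q ℕ.+ 1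

  2≤q : 2 ℕ.≤ q
  2≤q = ℕ.*-monoʳ-≤ 2 (ℕ.m^n>0 2 k)

  1≤p : 1 ℕ.≤ p
  1≤p = ℕ.pred-mono-≤ 2≤q

  q≤q² : q ℕ.≤ q ℕ.^ 2
  q≤q² = ≡.subst (ℕ._≤ q ℕ.^ 2) (ℕ.*-identityʳ q) (ℕ.^-monoʳ-≤ q {{ℕ.>-nonZero (ℕ.<-trans (s≤s z≤n) 2≤q)}} (s≤s (z≤n {1})))

  q²<q³ : q ℕ.^ 2 ℕ.< q ℕ.^ 3
  q²<q³ = ℕ.^-monoʳ-< q 2≤q (ℕ.n<1+n 2)

  q≡1+p : q ≡ suc p
  q≡1+p = ≡.sym (ℕ.suc-pred q {{ℕ.>-nonZero (ℕ.≤-trans (s≤s z≤n) 2≤q)}})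

  q^4≡1+p*K : q ℕ.^ 4 ≡ suc (p ℕ.* K)
  q^4≡1+p*K = ≡.subst (λ q → q ℕ.^ 4 ≡ suc (p ℕ.* (q ℕ.^ 3 ℕ.+ q ℕ.^ 2 ℕ.+ q ℕ.+ 1))) (≡.sym q≡1+p) ([1+p]^4≡1+p*Σ[1+p]^i p)

  open FiniteField E isField (HasCard-cast {R = E} q^4≡1+p*K card)

  char2 : CharacteristicTwo E
  char2 = characteristic-two (half ℕ.* q ℕ.^ 3) (≡.trans (≡.sym q^4≡1+p*K) (ℕ.*-assoc 2 half (q ℕ.^ 3)))

  open CharacteristicTwoProperties E char2
  open import Algebra.Properties.Ring ring using (+-cancelˡ)
  open Counting decSetoid using (FibresBoundedBy; fibre; fibre-large; preimage-by-counting)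
  open import Data.List.Relation.Unary.Unique.Setoid setoid using (Unique)
  open import Data.List.Membership.Setoid setoid using (_∈_)
  open import Data.List.Membership.Setoid.Properties using (∈-filter⁺)
  import Data.List.Relation.Unary.Unique.Setoid.Properties as Unique

  σ : Carrier → Carrier
  σ x = x ^ q

  σ-cong : ∀ {x y} → x ≈ y → σ x ≈ σ y
  σ-cong = ^-congˡ q

  σ-+ : ∀ x y → σ (x + y) ≈ σ x + σ y
  σ-+ = frobenius (suc k)

  σ-* : ∀ x y → σ (x * y) ≈ σ x * σ y
  σ-* x y = ^-distrib-* x y q

  σ-1 : σ 1# ≈ 1#
  σ-1 = 1^n≈1 q

  σ-0 : σ 0# ≈ 0#
  σ-0 = ≡.subst (λ n → 0# ^ n ≈ 0#) (≡.sym q≡1+p) (zeroˡ _)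

  σ-^ : ∀ x m → σ (x ^ m) ≈ σ x ^ m
  σ-^ x m = trans (^-assocʳ x m q) (trans (^-congʳ x (ℕ.*-comm m q)) (sym (^-assocʳ x q m)))

  σ-nonzero : ∀ {x} → x ≉ 0# → σ x ≉ 0#
  σ-nonzero = ^-nonzero q

  x^[q+1]≈x*σx : ∀ x → x ^ (q ℕ.+ 1) ≈ x * σ x
  x^[q+1]≈x*σx x = ^-congʳ x (ℕ.+-comm q 1)

  σ-^q^ : ∀ x i → σ (x ^ (q ℕ.^ i)) ≈ x ^ (q ℕ.^ suc i)
  σ-^q^ x i = trans (^-assocʳ x (q ℕ.^ i) q) (^-congʳ x (ℕ.*-comm (q ℕ.^ i) q))

  x^q²≈σ²x : ∀ x → x ^ (q ℕ.^ 2) ≈ σ (σ x)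
  x^q²≈σ²x x = trans (sym (σ-^q^ x 1)) (σ-cong (^-congʳ x (ℕ.*-identityʳ q)))

  x^q³≈σ³x : ∀ x → x ^ (q ℕ.^ 3) ≈ σ (σ (σ x))
  x^q³≈σ³x x = trans (sym (σ-^q^ x 2)) (σ-cong (x^q²≈σ²x x))

  σ⁴≈id : ∀ x → σ (σ (σ (σ x))) ≈ x
  σ⁴≈id x = begin
    σ (σ (σ (σ x)))      ≈⟨ σ-cong (x^q³≈σ³x x) ⟨
    σ (x ^ (q ℕ.^ 3))    ≈⟨ σ-^q^ x 3 ⟩
    x ^ (q ℕ.^ 4)        ≡⟨ ≡.cong (x ^_) q^4≡1+p*K ⟩
    x ^ suc (p ℕ.* K)    ≈⟨ fermat x ⟩
    x                    ∎

  norm : Carrier → Carrier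
  norm x = x * σ x * σ (σ x) * σ (σ (σ x))

  x^K≈norm : ∀ x → x ^ K ≈ norm x
  x^K≈norm x = begin
    x ^ (q ℕ.^ 3 ℕ.+ q ℕ.^ 2 ℕ.+ q ℕ.+ 1)
      ≈⟨ ^-homo-* x (q ℕ.^ 3 ℕ.+ q ℕ.^ 2 ℕ.+ q) 1 ⟩
    x ^ (q ℕ.^ 3 ℕ.+ q ℕ.^ 2 ℕ.+ q) * x ^ 1
      ≈⟨ *-congʳ (^-homo-* x (q ℕ.^ 3 ℕ.+ q ℕ.^ 2) q) ⟩
    x ^ (q ℕ.^ 3 ℕ.+ q ℕ.^ 2) * σ x * x ^ 1
      ≈⟨ *-congʳ (*-congʳ (^-homo-* x (q ℕ.^ 3) (q ℕ.^ 2))) ⟩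
    x ^ (q ℕ.^ 3) * x ^ (q ℕ.^ 2) * σ x * x ^ 1
      ≈⟨ *-cong (*-congʳ (*-cong (x^q³≈σ³x x) (x^q²≈σ²x x))) (*-identityʳ x) ⟩
    σ (σ (σ x)) * σ (σ x) * σ x * x
      ≈⟨ solve 4 (λ x₃ x₂ x₁ x → x₃ :* x₂ :* x₁ :* x := x :* x₁ :* x₂ :* x₃) refl (σ (σ (σ x))) (σ (σ x)) (σ x) x ⟩
    norm x ∎

  trace : Carrier → Carrier
  trace x = x + σ x + σ (σ x) + σ (σ (σ x))

  trace-cong : ∀ {x y} → x ≈ y → trace x ≈ trace y
  trace-cong x≈y = +-cong (+-cong (+-cong x≈y (σ-cong x≈y)) (σ-cong (σ-cong x≈y))) (σ-cong (σ-cong (σ-cong x≈y)))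

  trace-artin-schreier : ∀ z → trace (σ z + z) ≈ 0#
  trace-artin-schreier z = begin
    trace (σ z + z)
      ≈⟨ +-cong (+-cong (+-congˡ (σ-+ _ _)) σ²-+) (trans (σ-cong σ²-+) (σ-+ _ _)) ⟩
    (z₁ + z) + (z₂ + z₁) + (z₃ + z₂) + (z₄ + z₃)
      ≈⟨ solve 5 (λ z z₁ z₂ z₃ z₄ → (z₁ :+ z) :+ (z₂ :+ z₁) :+ (z₃ :+ z₂) :+ (z₄ :+ z₃)
                                    := z₄ :+ z :+ ((z₁ :+ z₁) :+ (z₂ :+ z₂) :+ (z₃ :+ z₃))) refl z z₁ z₂ z₃ z₄ ⟩
    z₄ + z + ((z₁ + z₁) + (z₂ + z₂) + (z₃ + z₃))
      ≈⟨ +-congˡ (trans (+-cong (+-cong (x+x≈0 z₁) (x+x≈0 z₂)) (x+x≈0 z₃)) (trans (+-identityʳ _) (+-identityʳ _))) ⟩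
    z₄ + z + 0#
      ≈⟨ +-identityʳ _ ⟩
    z₄ + z
      ≈⟨ x≈y⇒x+y≈0 (σ⁴≈id z) ⟩
    0# ∎
    where
    z₁ = σ z
    z₂ = σ z₁
    z₃ = σ z₂
    z₄ = σ z₃
    σ²-+ : σ (σ (z₁ + z)) ≈ z₃ + z₂
    σ²-+ = trans (σ-cong (σ-+ z₁ z)) (σ-+ z₂ z₁)

  monic-trace : Monic (q ℕ.^ 3) trace
  monic-trace = Monic-resp trace≈powers (monic-+ (monic-^ (q ℕ.^ 3)) lower-powers q²<q³)
    where
    lower-powers : Poly (q ℕ.^ 2) (λ y → y ^ (q ℕ.^ 2) + (σ y + y))
    lower-powers = poly-+ (monic⇒poly (monic-^ (q ℕ.^ 2)))
                          (poly-≤ q≤q² (poly-+ (monic⇒poly (monic-^ q)) (poly-≤ (ℕ.<⇒≤ 2≤q) poly-id)))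
    trace≈powers : ∀ y → trace y ≈ y ^ (q ℕ.^ 3) + (y ^ (q ℕ.^ 2) + (σ y + y))
    trace≈powers y =
      trans (solve 4 (λ y y₁ y₂ y₃ → y :+ y₁ :+ y₂ :+ y₃ := y₃ :+ (y₂ :+ (y₁ :+ y))) refl y (σ y) (σ (σ y)) (σ (σ (σ y))))
            (sym (+-cong (x^q³≈σ³x y) (+-congʳ (x^q²≈σ²x y))))

  x^half*x^half≈σx : ∀ x → x ^ half * x ^ half ≈ σ x
  x^half*x^half≈σx x = trans (sym (^-homo-* x half half)) (^-congʳ x (≡.cong (half ℕ.+_) (≡.sym (ℕ.+-identityʳ half))))

  -- x ↦ x^p sends the pK nonzero elements to the at most K elements of norm one, with fibres of at
  -- most p elements, so it is onto.
  hilbert90 : ∀ {ρ} → ρ ^ K ≈ 1# → ∃ λ v → v ≉ 0# × σ v ≈ v * ρ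
  hilbert90 {ρ} ρ^K≈1 = toRooted (preimage-by-counting power-fibres 1≤p
    (Allₚ.all-filter nonzero? elements) (Unique.filter⁺ setoid nonzero? elements-unique)
    powers-have-norm-one count (∈-filter⁺ setoid norm-one? norm-one-resp (∈-elements ρ) ρ^K≈1))
    where
    nonzero? = λ x → ¬? (x ≟ 0#)
    norm-one? = λ z → z ^ K ≟ 1#
    norm-one = filter norm-one? elements

    norm-one-resp : ∀ {x y} → x ≈ y → x ^ K ≈ 1# → y ^ K ≈ 1#
    norm-one-resp x≈y x^K≈1 = trans (^-congˡ K (sym x≈y)) x^K≈1

    power-fibres : FibresBoundedBy (_^ p) p
    power-fibres b ys! ys^p≈b = monic-roots (monic-+ (monic-^ p) (poly-constant b) 1≤p) ys! (All.map x≈y⇒x+y≈0 ys^p≈b)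

    powers-have-norm-one : All (λ x → x ^ p ∈ norm-one) nonzeroElements
    powers-have-norm-one = All.map (λ x≉0 → ∈-filter⁺ setoid norm-one? norm-one-resp (∈-elements _)
                                              (trans (^-assocʳ _ p K) (fermat-nonzero x≉0)))
                                   (Allₚ.all-filter nonzero? elements)

    count : length norm-one ℕ.* p ℕ.≤ length nonzeroElements
    count = ℕ.≤-trans (ℕ.*-monoˡ-≤ p norm-one≤K) (ℕ.≤-trans (ℕ.≤-reflexive (ℕ.*-comm K p)) n≤length-nonzeroElements)
      where
      norm-one≤K : length norm-one ℕ.≤ K
      norm-one≤K = monic-roots (monic-+ (monic-^ K) (poly-constant 1#) (ℕ.m≤n+m 1 _)) (Unique.filter⁺ setoid norm-one? elements-unique)
                               (All.map x≈y⇒x+y≈0 (Allₚ.all-filter norm-one? elements))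

    toRooted : (∃ λ w → w ≉ 0# × w ^ p ≈ ρ) → ∃ λ v → v ≉ 0# × σ v ≈ v * ρ
    toRooted (w , w≉0 , w^p≈ρ) = w , w≉0 , trans (^-congʳ w q≡1+p) (*-congˡ w^p≈ρ)

  -- z ↦ σz + z sends the q⁴ elements to the at most q³ traceless ones, with fibres of at most q
  -- elements, so every fibre over a traceless element is full.
  artin-schreier-fibre : ∀ {v} → trace v ≈ 0# → q ℕ.≤ length (fibre (λ z → σ z + z) v elements)
  artin-schreier-fibre {v} tr[v]≈0 = fibre-large artin-schreier-fibres elements-unique
    (All.universal (λ z → ∈-filter⁺ setoid traceless? traceless-resp (∈-elements _) (trace-artin-schreier z)) elements)
    count (∈-filter⁺ setoid traceless? traceless-resp (∈-elements v) tr[v]≈0)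
    where
    traceless? = λ z → trace z ≟ 0#
    traceless = filter traceless? elements

    traceless-resp : ∀ {x y} → x ≈ y → trace x ≈ 0# → trace y ≈ 0#
    traceless-resp x≈y tr[x]≈0 = trans (trace-cong (sym x≈y)) tr[x]≈0

    artin-schreier-fibres : FibresBoundedBy (λ z → σ z + z) q
    artin-schreier-fibres b ys! ys≈b = monic-roots (monic-+ (monic-^ q) (poly-+ poly-id (poly-≤ z≤n (poly-constant b))) 2≤q) ys!
      (All.map (λ σy+y≈b → trans (sym (+-assoc _ _ b)) (x≈y⇒x+y≈0 σy+y≈b)) ys≈b)

    count : length traceless ℕ.* q ℕ.≤ length elements
    count = ℕ.≤-trans (ℕ.*-monoˡ-≤ q traceless≤q³)
                      (ℕ.≤-reflexive (≡.trans (ℕ.*-comm (q ℕ.^ 3) q) (≡.trans q^4≡1+p*K (≡.sym length-elements))))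
      where
      traceless≤q³ : length traceless ℕ.≤ q ℕ.^ 3
      traceless≤q³ = monic-roots monic-trace (Unique.filter⁺ setoid traceless? elements-unique) (Allₚ.all-filter traceless? elements)

  σ-root : ∀ {a b x} → x * σ x ≈ a * x + b → σ x * σ (σ x) ≈ σ a * σ x + σ b
  σ-root {a} {b} {x} r = trans (sym (σ-* x (σ x))) (trans (σ-cong r) (trans (σ-+ (a * x) b) (+-congʳ (σ-* a x))))

  module Equation (α β : Carrier) (β∈P : InP E q β) (αβ : AlphaBeta E q α β) where
    α₁ α₂ β₁ β₂ β₃ : Carrier
    α₁ = σ α
    α₂ = σ α₁
    β₁ = σ β
    β₂ = σ β₁
    β₃ = σ β₂

    β^K≈1 : β ^ K ≈ 1#
    β^K≈1 = ≡.subst (_≈ 1#) (pow≡^ β K) β∈P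

    αα₁≈β₁+ββ₁β₂ : α * α₁ ≈ β₁ + β * β₁ * β₂
    αα₁≈β₁+ββ₁β₂ = begin
      α * σ α
        ≈⟨ x^[q+1]≈x*σx α ⟨
      α ^ (q ℕ.+ 1)
        ≡⟨ pow≡^ α (q ℕ.+ 1) ⟨
      pow E α (q ℕ.+ 1)
        ≈⟨ αβ ⟩
      pow E β q + pow E β (q ℕ.^ 2 ℕ.+ q ℕ.+ 1)
        ≡⟨ ≡.cong₂ _+_ (pow≡^ β q) (pow≡^ β (q ℕ.^ 2 ℕ.+ q ℕ.+ 1)) ⟩
      β₁ + β ^ (q ℕ.^ 2 ℕ.+ q ℕ.+ 1)
        ≈⟨ +-congˡ (^-homo-* β (q ℕ.^ 2 ℕ.+ q) 1) ⟩
      β₁ + β ^ (q ℕ.^ 2 ℕ.+ q) * β ^ 1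
        ≈⟨ +-congˡ (*-cong (trans (^-homo-* β (q ℕ.^ 2) q) (*-congʳ (x^q²≈σ²x β))) (*-identityʳ β)) ⟩
      β₁ + β₂ * β₁ * β
        ≈⟨ +-congˡ (solve 3 (λ b b₁ b₂ → b₂ :* b₁ :* b := b :* b₁ :* b₂) refl β β₁ β₂) ⟩
      β₁ + β * β₁ * β₂ ∎

    Root : Carrier → Set ℓ
    Root x = x * σ x ≈ α * x + β

    norm-β≈1 : β * β₁ * β₂ * β₃ ≈ 1#
    norm-β≈1 = trans (sym (x^K≈norm β)) β^K≈1

    β≉0 : β ≉ 0#
    β≉0 = x*y≈1⇒y≉0 (trans (solve 4 (λ b b₁ b₂ b₃ → b₁ :* b₂ :* b₃ :* b := b :* b₁ :* b₂ :* b₃) refl β β₁ β₂ β₃) norm-β≈1)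

    α₁α₂≈β₂+β₁β₂β₃ : α₁ * α₂ ≈ β₂ + β₁ * β₂ * β₃
    α₁α₂≈β₂+β₁β₂β₃ = trans (sym (σ-* α α₁))
      (trans (σ-cong αα₁≈β₁+ββ₁β₂) (trans (σ-+ _ _) (+-congˡ (trans (σ-* _ _) (*-congʳ (σ-* _ _))))))

    α₂ββ₁≈α : α₂ * β * β₁ ≈ α
    α₂ββ₁≈α = by-cases (α ≟ 0#)
      where
      -- Not `with α ≟ 0#`: that normalises the goal through the enumeration of E, which is very slow.
      by-cases : Dec (α ≈ 0#) → α₂ * β * β₁ ≈ α
      by-cases (yes α≈0) = trans (*-congʳ (*-congʳ α₂≈0)) (trans (*-congʳ (zeroˡ β)) (trans (zeroˡ β₁) (sym α≈0)))
        where α₂≈0 = trans (σ-cong (trans (σ-cong α≈0) σ-0)) σ-0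
      by-cases (no α≉0) = *-cancelˡ-nonzero (σ-nonzero α≉0) (begin
        α₁ * (α₂ * β * β₁)
          ≈⟨ solve 4 (λ a₁ a₂ b b₁ → a₁ :* (a₂ :* b :* b₁) := a₁ :* a₂ :* (b :* b₁)) refl α₁ α₂ β β₁ ⟩
        α₁ * α₂ * (β * β₁)
          ≈⟨ *-congʳ α₁α₂≈β₂+β₁β₂β₃ ⟩
        (β₂ + β₁ * β₂ * β₃) * (β * β₁)
          ≈⟨ solve 4 (λ b b₁ b₂ b₃ → (b₂ :+ b₁ :* b₂ :* b₃) :* (b :* b₁) := b₁ :* (b :* b₁ :* b₂ :* b₃) :+ b :* b₁ :* b₂) refl β β₁ β₂ β₃ ⟩
        β₁ * (β * β₁ * β₂ * β₃) + β * β₁ * β₂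
          ≈⟨ +-congʳ (trans (*-congˡ norm-β≈1) (*-identityʳ β₁)) ⟩
        β₁ + β * β₁ * β₂
          ≈⟨ αα₁≈β₁+ββ₁β₂ ⟨
        α * α₁
          ≈⟨ *-comm α α₁ ⟩
        α₁ * α ∎)

    root-nonzero : ∀ {x} → Root x → x ≉ 0#
    root-nonzero {x} r x≈0 = β≉0 (begin
      β              ≈⟨ +-identityˡ β ⟨
      0# + β         ≈⟨ +-congʳ (trans (*-congˡ x≈0) (zeroʳ α)) ⟨
      α * x + β      ≈⟨ r ⟨
      x * σ x        ≈⟨ trans (*-congʳ x≈0) (zeroˡ _) ⟩
      0#             ∎)

    root-norm : ∀ {x} → Root x → norm x ≈ 1#
    root-norm {x} r₀ = begin
      x * x₁ * x₂ * x₃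
        ≈⟨ solve 4 (λ x x₁ x₂ x₃ → x :* x₁ :* x₂ :* x₃ := x :* x₁ :* (x₂ :* x₃)) refl x x₁ x₂ x₃ ⟩
      x * x₁ * (x₂ * x₃)
        ≈⟨ *-congˡ r₂ ⟩
      x * x₁ * (α₂ * x₂ + β₂)
        ≈⟨ solve 5 (λ x x₁ x₂ a₂ b₂ → x :* x₁ :* (a₂ :* x₂ :+ b₂) := a₂ :* x :* (x₁ :* x₂) :+ b₂ :* (x :* x₁)) refl x x₁ x₂ α₂ β₂ ⟩
      α₂ * x * (x₁ * x₂) + β₂ * (x * x₁)
        ≈⟨ +-cong (*-congˡ r₁) (*-congˡ r₀) ⟩
      α₂ * x * (α₁ * x₁ + β₁) + β₂ * (α * x + β)
        ≈⟨ +-congʳ (solve 5 (λ x x₁ a₁ a₂ b₁ → a₂ :* x :* (a₁ :* x₁ :+ b₁) := a₂ :* a₁ :* (x :* x₁) :+ a₂ :* b₁ :* x) refl x x₁ α₁ α₂ β₁) ⟩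
      α₂ * α₁ * (x * x₁) + α₂ * β₁ * x + β₂ * (α * x + β)
        ≈⟨ +-congʳ (+-congʳ (*-congˡ r₀)) ⟩
      α₂ * α₁ * (α * x + β) + α₂ * β₁ * x + β₂ * (α * x + β)
        ≈⟨ solve 7 (λ x a a₁ a₂ b b₁ b₂ → a₂ :* a₁ :* (a :* x :+ b) :+ a₂ :* b₁ :* x :+ b₂ :* (a :* x :+ b)
                                          := x :* (a :* a₁ :* a₂ :+ a₂ :* b₁ :+ a :* b₂) :+ b :* (a₁ :* a₂ :+ b₂)) refl x α α₁ α₂ β β₁ β₂ ⟩
      x * (α * α₁ * α₂ + α₂ * β₁ + α * β₂) + β * (α₁ * α₂ + β₂)
        ≈⟨ +-cong (*-congˡ x-coefficient≈0) constant≈1 ⟩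
      x * 0# + 1#
        ≈⟨ trans (+-congʳ (zeroʳ x)) (+-identityˡ 1#) ⟩
      1# ∎
      where
      x₁ = σ x
      x₂ = σ x₁
      x₃ = σ x₂
      r₁ = σ-root r₀
      r₂ = σ-root r₁
      constant≈1 : β * (α₁ * α₂ + β₂) ≈ 1#
      constant≈1 = begin
        β * (α₁ * α₂ + β₂)
          ≈⟨ *-congˡ (+-congʳ α₁α₂≈β₂+β₁β₂β₃) ⟩
        β * (β₂ + β₁ * β₂ * β₃ + β₂)
          ≈⟨ solve 4 (λ b b₁ b₂ b₃ → b :* (b₂ :+ b₁ :* b₂ :* b₃ :+ b₂) := b :* b₁ :* b₂ :* b₃ :+ (b :* b₂ :+ b :* b₂)) refl β β₁ β₂ β₃ ⟩
        β * β₁ * β₂ * β₃ + (β * β₂ + β * β₂)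
          ≈⟨ x+[y+y]≈x _ _ ⟩
        β * β₁ * β₂ * β₃
          ≈⟨ norm-β≈1 ⟩
        1# ∎
      x-coefficient≈0 : α * α₁ * α₂ + α₂ * β₁ + α * β₂ ≈ 0#
      x-coefficient≈0 = begin
        α * α₁ * α₂ + α₂ * β₁ + α * β₂
          ≈⟨ +-congʳ (+-congʳ (*-congʳ αα₁≈β₁+ββ₁β₂)) ⟩
        (β₁ + β * β₁ * β₂) * α₂ + α₂ * β₁ + α * β₂
          ≈⟨ solve 5 (λ a a₂ b b₁ b₂ → (b₁ :+ b :* b₁ :* b₂) :* a₂ :+ a₂ :* b₁ :+ a :* b₂
                                       := b₂ :* (a₂ :* b :* b₁) :+ a :* b₂ :+ (a₂ :* b₁ :+ a₂ :* b₁)) refl α α₂ β β₁ β₂ ⟩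
        β₂ * (α₂ * β * β₁) + α * β₂ + (α₂ * β₁ + α₂ * β₁)
          ≈⟨ x+[y+y]≈x _ _ ⟩
        β₂ * (α₂ * β * β₁) + α * β₂
          ≈⟨ +-congʳ (trans (*-congˡ α₂ββ₁≈α) (*-comm β₂ α)) ⟩
        α * β₂ + α * β₂
          ≈⟨ x+x≈0 _ ⟩
        0# ∎

    -- Here ββ₂ = 1, and (y^(q/2))² = σy.
    root-exists-α≈0 : α ≈ 0# → ∃ Root
    root-exists-α≈0 α≈0 = x₀ , (begin
      x₀ * σ x₀                          ≈⟨ *-congˡ (σ-^ (β₂ * β₃) half) ⟩
      x₀ * σ (β₂ * β₃) ^ half            ≈⟨ ^-distrib-* (β₂ * β₃) (σ (β₂ * β₃)) half ⟨
      (β₂ * β₃ * σ (β₂ * β₃)) ^ half     ≈⟨ ^-congˡ half β₂β₃σ[β₂β₃]≈β₃β₃ ⟩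
      (β₃ * β₃) ^ half                   ≈⟨ ^-distrib-* β₃ β₃ half ⟩
      β₃ ^ half * β₃ ^ half              ≈⟨ x^half*x^half≈σx β₃ ⟩
      σ β₃                               ≈⟨ σ⁴≈id β ⟩
      β                                  ≈⟨ +-identityˡ β ⟨
      0# + β                             ≈⟨ +-congʳ (trans (*-congʳ α≈0) (zeroˡ x₀)) ⟨
      α * x₀ + β                         ∎)
      where
      x₀ = (β₂ * β₃) ^ half
      ββ₂≈1 : β * β₂ ≈ 1#
      ββ₂≈1 = sym (*-cancelˡ-nonzero (σ-nonzero β≉0) (begin
        β₁ * 1#               ≈⟨ *-identityʳ β₁ ⟩
        β₁                    ≈⟨ x+y≈0⇒x≈y (trans (sym αα₁≈β₁+ββ₁β₂) (trans (*-congʳ α≈0) (zeroˡ α₁))) ⟩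
        β * β₁ * β₂           ≈⟨ solve 3 (λ b b₁ b₂ → b :* b₁ :* b₂ := b₁ :* (b :* b₂)) refl β β₁ β₂ ⟩
        β₁ * (β * β₂)         ∎))
      β₂β₃σ[β₂β₃]≈β₃β₃ : β₂ * β₃ * σ (β₂ * β₃) ≈ β₃ * β₃
      β₂β₃σ[β₂β₃]≈β₃β₃ = begin
        β₂ * β₃ * σ (β₂ * β₃)     ≈⟨ *-congˡ (trans (σ-* β₂ β₃) (*-congˡ (σ⁴≈id β))) ⟩
        β₂ * β₃ * (β₃ * β)        ≈⟨ solve 3 (λ b b₂ b₃ → b₂ :* b₃ :* (b₃ :* b) := b :* b₂ :* (b₃ :* b₃)) refl β β₂ β₃ ⟩
        β * β₂ * (β₃ * β₃)        ≈⟨ trans (*-congʳ ββ₂≈1) (*-identityˡ _) ⟩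
        β₃ * β₃                   ∎

    -- g = (ββ₂)^(q/2) satisfies g·σg = 1 and σg = g·ββ₂, which makes β(1 + g)/α a root.
    root-exists-α≉0 : α ≉ 0# → ∃ Root
    root-exists-α≉0 α≉0 = x₀ , (begin
      x₀ * σ x₀
        ≈⟨ *-congˡ σx₀≈ ⟩
      β * (1# + g) * α ⁻¹ * (β₁ * (1# + σ g) * σ (α ⁻¹))
        ≈⟨ solve 6 (λ b b₁ s s₁ i i₁ → b :* s :* i :* (b₁ :* s₁ :* i₁)
                                       := b :* (s :* s₁) :* (b₁ :* (i :* i₁))) refl β β₁ (1# + g) (1# + σ g) (α ⁻¹) (σ (α ⁻¹)) ⟩
      β * ((1# + g) * (1# + σ g)) * (β₁ * (α ⁻¹ * σ (α ⁻¹)))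
        ≈⟨ *-congʳ (*-congˡ [1+g][1+σg]≈g[1+γ]) ⟩
      β * (g * (1# + γ)) * (β₁ * (α ⁻¹ * σ (α ⁻¹)))
        ≈⟨ solve 6 (λ b b₁ b₂ g i i₁ → b :* (g :* (con 1 :+ b :* b₂)) :* (b₁ :* (i :* i₁))
                                       := b :* g :* ((b₁ :+ b :* b₁ :* b₂) :* (i :* i₁))) refl β β₁ β₂ g (α ⁻¹) (σ (α ⁻¹)) ⟩
      β * g * ((β₁ + β * β₁ * β₂) * (α ⁻¹ * σ (α ⁻¹)))
        ≈⟨ *-congˡ (*-congʳ αα₁≈β₁+ββ₁β₂) ⟨
      β * g * (α * α₁ * (α ⁻¹ * σ (α ⁻¹)))
        ≈⟨ *-congˡ αα₁α⁻¹σ[α⁻¹]≈1 ⟩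
      β * g * 1#
        ≈⟨ *-identityʳ _ ⟩
      β * g
        ≈⟨ x+[y+y]≈x _ β ⟨
      β * g + (β + β)
        ≈⟨ solve 2 (λ b g → b :* g :+ (b :+ b) := b :* (con 1 :+ g) :* con 1 :+ b) refl β g ⟩
      β * (1# + g) * 1# + β
        ≈⟨ +-congʳ (*-congˡ (x*x⁻¹≈1 α≉0)) ⟨
      β * (1# + g) * (α * α ⁻¹) + β
        ≈⟨ +-congʳ (solve 4 (λ b g a i → b :* (con 1 :+ g) :* (a :* i) := a :* (b :* (con 1 :+ g) :* i)) refl β g α (α ⁻¹)) ⟩
      α * x₀ + β ∎)
      where
      γ = β * β₂
      g = γ ^ half
      x₀ = β * (1# + g) * α ⁻¹

      σx₀≈ : σ x₀ ≈ β₁ * (1# + σ g) * σ (α ⁻¹)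
      σx₀≈ = trans (σ-* _ _) (*-congʳ (trans (σ-* _ _) (*-congˡ (trans (σ-+ 1# g) (+-congʳ σ-1)))))

      γσγ≈1 : γ * σ γ ≈ 1#
      γσγ≈1 = trans (*-congˡ (σ-* β β₂)) (trans (solve 4 (λ b b₁ b₂ b₃ → b :* b₂ :* (b₁ :* b₃) := b :* b₁ :* b₂ :* b₃) refl β β₁ β₂ β₃) norm-β≈1)

      gσg≈1 : g * σ g ≈ 1#
      gσg≈1 = trans (*-congˡ (σ-^ γ half)) (trans (sym (^-distrib-* γ (σ γ) half)) (trans (^-congˡ half γσγ≈1) (1^n≈1 half)))

      σg≈gγ : σ g ≈ g * γ
      σg≈gγ = *-cancelˡ-nonzero (x*y≈1⇒y≉0 (trans (*-comm (σ g) g) gσg≈1)) (begin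
        g * σ g        ≈⟨ gσg≈1 ⟩
        1#             ≈⟨ γσγ≈1 ⟨
        γ * σ γ        ≈⟨ *-congˡ (x^half*x^half≈σx γ) ⟨
        γ * (g * g)    ≈⟨ solve 2 (λ γ g → γ :* (g :* g) := g :* (g :* γ)) refl γ g ⟩
        g * (g * γ)    ∎)

      [1+g][1+σg]≈g[1+γ] : (1# + g) * (1# + σ g) ≈ g * (1# + γ)
      [1+g][1+σg]≈g[1+γ] = begin
        (1# + g) * (1# + σ g)     ≈⟨ solve 2 (λ g g₁ → (con 1 :+ g) :* (con 1 :+ g₁) := g :+ g₁ :+ (con 1 :+ g :* g₁)) refl g (σ g) ⟩
        g + σ g + (1# + g * σ g)  ≈⟨ +-congˡ (+-congˡ gσg≈1) ⟩
        g + σ g + (1# + 1#)       ≈⟨ x+[y+y]≈x _ 1# ⟩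
        g + σ g                   ≈⟨ +-congˡ σg≈gγ ⟩
        g + g * γ                 ≈⟨ solve 2 (λ g γ → g :+ g :* γ := g :* (con 1 :+ γ)) refl g γ ⟩
        g * (1# + γ)              ∎

      αα₁α⁻¹σ[α⁻¹]≈1 : α * α₁ * (α ⁻¹ * σ (α ⁻¹)) ≈ 1#
      αα₁α⁻¹σ[α⁻¹]≈1 = begin
        α * α₁ * (α ⁻¹ * σ (α ⁻¹))    ≈⟨ solve 4 (λ a a₁ i i₁ → a :* a₁ :* (i :* i₁) := a :* i :* (a₁ :* i₁)) refl α α₁ (α ⁻¹) (σ (α ⁻¹)) ⟩
        α * α ⁻¹ * (α₁ * σ (α ⁻¹))    ≈⟨ *-congˡ (σ-* α (α ⁻¹)) ⟨
        α * α ⁻¹ * σ (α * α ⁻¹)       ≈⟨ *-cong (x*x⁻¹≈1 α≉0) (trans (σ-cong (x*x⁻¹≈1 α≉0)) σ-1) ⟩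
        1# * 1#                       ≈⟨ *-identityˡ 1# ⟩
        1#                            ∎

    root-exists : ∃ Root
    root-exists = by-cases (α ≟ 0#)
      where
      by-cases : Dec (α ≈ 0#) → ∃ Root
      by-cases (yes α≈0) = root-exists-α≈0 α≈0
      by-cases (no  α≉0) = root-exists-α≉0 α≉0

    x₀x₁x₁x₂+βx₁x₂+ββ₁+ββ₁β₂x₀x₁≈0 : ∀ {x} → Root x →
      x * σ x * (σ x * σ (σ x)) + β * (σ x * σ (σ x)) + β * β₁ + β * β₁ * β₂ * (x * σ x) ≈ 0#
    x₀x₁x₁x₂+βx₁x₂+ββ₁+ββ₁β₂x₀x₁≈0 {x} r₀ = begin
      x * x₁ * (x₁ * x₂) + β * (x₁ * x₂) + β * β₁ + β * β₁ * β₂ * (x * x₁)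
        ≈⟨ solve 6 (λ x x₁ x₂ b b₁ b₂ → x :* x₁ :* (x₁ :* x₂) :+ b :* (x₁ :* x₂) :+ b :* b₁ :+ b :* b₁ :* b₂ :* (x :* x₁)
                                      := (x :* x₁ :+ b) :* (x₁ :* x₂) :+ b :* b₁ :+ b :* b₁ :* b₂ :* (x :* x₁)) refl x x₁ x₂ β β₁ β₂ ⟩
      (x * x₁ + β) * (x₁ * x₂) + β * β₁ + β * β₁ * β₂ * (x * x₁)
        ≈⟨ +-congʳ (+-congʳ (*-cong x₀x₁+β≈αx₀ (σ-root r₀))) ⟩
      α * x * (α₁ * x₁ + β₁) + β * β₁ + β * β₁ * β₂ * (x * x₁)
        ≈⟨ solve 7 (λ x x₁ a a₁ b b₁ b₂ → a :* x :* (a₁ :* x₁ :+ b₁) :+ b :* b₁ :+ b :* b₁ :* b₂ :* (x :* x₁)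
                                       := a :* a₁ :* (x :* x₁) :+ b₁ :* (a :* x :+ b) :+ b :* b₁ :* b₂ :* (x :* x₁)) refl x x₁ α α₁ β β₁ β₂ ⟩
      α * α₁ * (x * x₁) + β₁ * (α * x + β) + β * β₁ * β₂ * (x * x₁)
        ≈⟨ +-congʳ (+-cong (*-congʳ αα₁≈β₁+ββ₁β₂) (*-congˡ (sym r₀))) ⟩
      (β₁ + β * β₁ * β₂) * (x * x₁) + β₁ * (x * x₁) + β * β₁ * β₂ * (x * x₁)
        ≈⟨ solve 4 (λ b b₁ b₂ y → (b₁ :+ b :* b₁ :* b₂) :* y :+ b₁ :* y :+ b :* b₁ :* b₂ :* y
                                := (b₁ :* y :+ b₁ :* y) :+ (b :* b₁ :* b₂ :* y :+ b :* b₁ :* b₂ :* y)) refl β β₁ β₂ (x * x₁) ⟩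
      (β₁ * (x * x₁) + β₁ * (x * x₁)) + (β * β₁ * β₂ * (x * x₁) + β * β₁ * β₂ * (x * x₁))
        ≈⟨ trans (+-cong (x+x≈0 _) (x+x≈0 _)) (+-identityˡ 0#) ⟩
      0# ∎
      where
      x₁ = σ x
      x₂ = σ x₁
      x₀x₁+β≈αx₀ : x * x₁ + β ≈ α * x
      x₀x₁+β≈αx₀ = trans (+-congʳ r₀) (trans (+-assoc _ β β) (x+[y+y]≈x _ β))

    -- With Pᵢ = xᵢxᵢ₊₁, the hypothesis and its conjugates give Pᵢ vᵢ₊₁ = βᵢ vᵢ, and P₀P₂ = norm x = 1.
    trace-zero : ∀ {x v} → Root x → x * σ x * σ v ≈ β * v → trace v ≈ 0#
    trace-zero {x} {v} r₀ s₀ = x*y≈0⇒y≈0 (*-nonzero P₀≉0 P₁≉0) (begin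
      P₀ * P₁ * (v + v₁ + v₂ + v₃)
        ≈⟨ solve 6 (λ P₀ P₁ v v₁ v₂ v₃ → P₀ :* P₁ :* (v :+ v₁ :+ v₂ :+ v₃)
                                         := v :* (P₀ :* P₁) :+ P₀ :* P₁ :* v₁ :+ P₀ :* P₁ :* v₂ :+ P₀ :* P₁ :* v₃) refl P₀ P₁ v v₁ v₂ v₃ ⟩
      v * (P₀ * P₁) + P₀ * P₁ * v₁ + P₀ * P₁ * v₂ + P₀ * P₁ * v₃
        ≈⟨ +-cong (+-cong (+-congˡ t₁) t₂) t₃ ⟩
      v * (P₀ * P₁) + v * (β * P₁) + v * (β * β₁) + v * (β * β₁ * β₂ * P₀)
        ≈⟨ solve 6 (λ v P₀ P₁ b b₁ b₂ → v :* (P₀ :* P₁) :+ v :* (b :* P₁) :+ v :* (b :* b₁) :+ v :* (b :* b₁ :* b₂ :* P₀)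
                                        := v :* (P₀ :* P₁ :+ b :* P₁ :+ b :* b₁ :+ b :* b₁ :* b₂ :* P₀)) refl v P₀ P₁ β β₁ β₂ ⟩
      v * (P₀ * P₁ + β * P₁ + β * β₁ + β * β₁ * β₂ * P₀)
        ≈⟨ *-congˡ (x₀x₁x₁x₂+βx₁x₂+ββ₁+ββ₁β₂x₀x₁≈0 r₀) ⟩
      v * 0#
        ≈⟨ zeroʳ v ⟩
      0# ∎)
      where
      x₁ = σ x
      x₂ = σ x₁
      x₃ = σ x₂
      v₁ = σ v
      v₂ = σ v₁
      v₃ = σ v₂
      P₀ = x * x₁
      P₁ = x₁ * x₂
      P₂ = x₂ * x₃

      P₀≉0 : P₀ ≉ 0#
      P₀≉0 = *-nonzero (root-nonzero r₀) (σ-nonzero (root-nonzero r₀))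
      P₁≉0 : P₁ ≉ 0#
      P₁≉0 = *-nonzero (σ-nonzero (root-nonzero r₀)) (σ-nonzero (σ-nonzero (root-nonzero r₀)))

      σ-step : ∀ {a b c d e} → a * b * c ≈ d * e → σ a * σ b * σ c ≈ σ d * σ e
      σ-step {a} {b} {c} {d} {e} abc≈de = trans (sym (trans (σ-* (a * b) c) (*-congʳ (σ-* a b)))) (trans (σ-cong abc≈de) (σ-* d e))

      s₁ : P₁ * v₂ ≈ β₁ * v₁
      s₁ = σ-step s₀
      s₂ : P₂ * v₃ ≈ β₂ * v₂
      s₂ = σ-step s₁
      P₀P₂≈1 : P₀ * P₂ ≈ 1#
      P₀P₂≈1 = trans (sym (*-assoc P₀ x₂ x₃)) (root-norm r₀)

      t₁ : P₀ * P₁ * v₁ ≈ v * (β * P₁)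
      t₁ = begin
        P₀ * P₁ * v₁      ≈⟨ solve 3 (λ P₀ P₁ v₁ → P₀ :* P₁ :* v₁ := P₁ :* (P₀ :* v₁)) refl P₀ P₁ v₁ ⟩
        P₁ * (P₀ * v₁)    ≈⟨ *-congˡ s₀ ⟩
        P₁ * (β * v)      ≈⟨ solve 3 (λ P₁ b v → P₁ :* (b :* v) := v :* (b :* P₁)) refl P₁ β v ⟩
        v * (β * P₁)      ∎
      t₂ : P₀ * P₁ * v₂ ≈ v * (β * β₁)
      t₂ = begin
        P₀ * P₁ * v₂      ≈⟨ *-assoc P₀ P₁ v₂ ⟩
        P₀ * (P₁ * v₂)    ≈⟨ *-congˡ s₁ ⟩
        P₀ * (β₁ * v₁)    ≈⟨ solve 3 (λ P₀ b₁ v₁ → P₀ :* (b₁ :* v₁) := b₁ :* (P₀ :* v₁)) refl P₀ β₁ v₁ ⟩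
        β₁ * (P₀ * v₁)    ≈⟨ *-congˡ s₀ ⟩
        β₁ * (β * v)      ≈⟨ solve 3 (λ b₁ b v → b₁ :* (b :* v) := v :* (b :* b₁)) refl β₁ β v ⟩
        v * (β * β₁)      ∎
      t₃ : P₀ * P₁ * v₃ ≈ v * (β * β₁ * β₂ * P₀)
      t₃ = begin
        P₀ * P₁ * v₃
          ≈⟨ *-identityʳ _ ⟨
        P₀ * P₁ * v₃ * 1#
          ≈⟨ *-congˡ P₀P₂≈1 ⟨
        P₀ * P₁ * v₃ * (P₀ * P₂)
          ≈⟨ solve 4 (λ P₀ P₁ P₂ v₃ → P₀ :* P₁ :* v₃ :* (P₀ :* P₂) := P₀ :* P₁ :* P₀ :* (P₂ :* v₃)) refl P₀ P₁ P₂ v₃ ⟩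
        P₀ * P₁ * P₀ * (P₂ * v₃)
          ≈⟨ *-congˡ s₂ ⟩
        P₀ * P₁ * P₀ * (β₂ * v₂)
          ≈⟨ solve 4 (λ P₀ P₁ b₂ v₂ → P₀ :* P₁ :* P₀ :* (b₂ :* v₂) := b₂ :* P₀ :* (P₀ :* P₁ :* v₂)) refl P₀ P₁ β₂ v₂ ⟩
        β₂ * P₀ * (P₀ * P₁ * v₂)
          ≈⟨ *-congˡ t₂ ⟩
        β₂ * P₀ * (v * (β * β₁))
          ≈⟨ solve 5 (λ b₂ P₀ v b b₁ → b₂ :* P₀ :* (v :* (b :* b₁)) := v :* (b :* b₁ :* b₂ :* P₀)) refl β₂ P₀ v β β₁ ⟩
        v * (β * β₁ * β₂ * P₀) ∎

    -- Multiplying the equation for x by z·σz turns it into the one for x₀, via z = σz + v and σ²z = σz + σv.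
    x*z≈x₀*σz⇒root : ∀ {x₀ v x z} → Root x₀ → x₀ * σ x₀ * σ v ≈ β * v →
                     z ≉ 0# → σ z + z ≈ v → x * z ≈ x₀ * σ z → Root x
    x*z≈x₀*σz⇒root {x₀} {v} {x} {z} r₀ s₀ z≉0 σz+z≈v xz≈x₀σz = *-cancelʳ-nonzero (*-nonzero z≉0 (σ-nonzero z≉0)) (begin
      x * σ x * (z * σ z)
        ≈⟨ solve 4 (λ x x₁ z z₁ → x :* x₁ :* (z :* z₁) := x :* z :* (x₁ :* z₁)) refl x (σ x) z (σ z) ⟩
      x * z * (σ x * σ z)
        ≈⟨ *-cong xz≈x₀σz (trans (sym (σ-* x z)) (trans (σ-cong xz≈x₀σz) (σ-* x₀ (σ z)))) ⟩
      x₀ * σ z * (σ x₀ * σ (σ z))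
        ≈⟨ solve 4 (λ x₀ x₁ z₁ z₂ → x₀ :* z₁ :* (x₁ :* z₂) := z₁ :* (x₀ :* x₁ :* z₂)) refl x₀ (σ x₀) (σ z) (σ (σ z)) ⟩
      σ z * (x₀ * σ x₀ * σ (σ z))
        ≈⟨ *-congˡ x₀x₁σ²z≈αx₀σz+βz ⟩
      σ z * (α * x₀ * σ z + β * z)
        ≈⟨ solve 5 (λ a b x₀ z z₁ → z₁ :* (a :* x₀ :* z₁ :+ b :* z) := a :* (x₀ :* z₁) :* z₁ :+ b :* (z :* z₁)) refl α β x₀ z (σ z) ⟩
      α * (x₀ * σ z) * σ z + β * (z * σ z)
        ≈⟨ +-congʳ (*-congʳ (*-congˡ xz≈x₀σz)) ⟨
      α * (x * z) * σ z + β * (z * σ z)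
        ≈⟨ solve 5 (λ a b x z z₁ → a :* (x :* z) :* z₁ :+ b :* (z :* z₁) := (a :* x :+ b) :* (z :* z₁)) refl α β x z (σ z) ⟩
      (α * x + β) * (z * σ z) ∎)
      where
      x₀x₁σ²z≈αx₀σz+βz : x₀ * σ x₀ * σ (σ z) ≈ α * x₀ * σ z + β * z
      x₀x₁σ²z≈αx₀σz+βz = begin
        x₀ * σ x₀ * σ (σ z)
          ≈⟨ x+[y+y]≈x _ _ ⟨
        x₀ * σ x₀ * σ (σ z) + (x₀ * σ x₀ * σ z + x₀ * σ x₀ * σ z)
          ≈⟨ solve 3 (λ P z₁ z₂ → P :* z₂ :+ (P :* z₁ :+ P :* z₁) := P :* (z₂ :+ z₁) :+ P :* z₁) refl (x₀ * σ x₀) (σ z) (σ (σ z)) ⟩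
        x₀ * σ x₀ * (σ (σ z) + σ z) + x₀ * σ x₀ * σ z
          ≈⟨ +-cong (*-congˡ (trans (sym (σ-+ (σ z) z)) (σ-cong σz+z≈v))) (*-congʳ r₀) ⟩
        x₀ * σ x₀ * σ v + (α * x₀ + β) * σ z
          ≈⟨ +-congʳ s₀ ⟩
        β * v + (α * x₀ + β) * σ z
          ≈⟨ solve 5 (λ a b x₀ v z₁ → b :* v :+ (a :* x₀ :+ b) :* z₁ := a :* x₀ :* z₁ :+ b :* (z₁ :+ v)) refl α β x₀ v (σ z) ⟩
        α * x₀ * σ z + β * (σ z + v)
          ≈⟨ +-congˡ (*-congˡ (x+y≈z⇒x+z≈y σz+z≈v)) ⟩
        α * x₀ * σ z + β * z ∎

    -- Hilbert 90 for β/(x₀·σx₀), which has norm 1 because β and x₀ do.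
    x₀x₁σv≈βv-solvable : ∀ {x₀} → Root x₀ → ∃ λ v → v ≉ 0# × x₀ * σ x₀ * σ v ≈ β * v
    x₀x₁σv≈βv-solvable {x₀} x₀-root = scale (hilbert90 ρ^K≈1)
      where
      P₀ = x₀ * σ x₀
      P₀≉0 = *-nonzero (root-nonzero x₀-root) (σ-nonzero (root-nonzero x₀-root))
      ρ = β * P₀ ⁻¹

      P₀^K≈1 : P₀ ^ K ≈ 1#
      P₀^K≈1 = begin
        (x₀ * σ x₀) ^ K        ≈⟨ ^-distrib-* x₀ (σ x₀) K ⟩
        x₀ ^ K * σ x₀ ^ K      ≈⟨ *-congˡ (σ-^ x₀ K) ⟨
        x₀ ^ K * σ (x₀ ^ K)    ≈⟨ *-cong x₀^K≈1 (trans (σ-cong x₀^K≈1) σ-1) ⟩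
        1# * 1#                ≈⟨ *-identityˡ 1# ⟩
        1#                     ∎
        where x₀^K≈1 = trans (x^K≈norm x₀) (root-norm x₀-root)

      ρ^K≈1 : ρ ^ K ≈ 1#
      ρ^K≈1 = begin
        (β * P₀ ⁻¹) ^ K                    ≈⟨ ^-distrib-* β (P₀ ⁻¹) K ⟩
        β ^ K * (P₀ ⁻¹) ^ K                 ≈⟨ *-cong β^K≈1 (sym (*-identityʳ _)) ⟩
        1# * ((P₀ ⁻¹) ^ K * 1#)             ≈⟨ *-congˡ (*-congˡ P₀^K≈1) ⟨
        1# * ((P₀ ⁻¹) ^ K * P₀ ^ K)          ≈⟨ *-congˡ (^-distrib-* (P₀ ⁻¹) P₀ K) ⟨
        1# * (P₀ ⁻¹ * P₀) ^ K               ≈⟨ *-congˡ (^-congˡ K (trans (*-comm (P₀ ⁻¹) P₀) (x*x⁻¹≈1 P₀≉0))) ⟩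
        1# * 1# ^ K                         ≈⟨ trans (*-identityˡ _) (1^n≈1 K) ⟩
        1#                                  ∎

      scale : (∃ λ v → v ≉ 0# × σ v ≈ v * ρ) → ∃ λ v → v ≉ 0# × P₀ * σ v ≈ β * v
      scale (v , v≉0 , σv≈vρ) = v , v≉0 , (begin
        P₀ * σ v                ≈⟨ *-congˡ σv≈vρ ⟩
        P₀ * (v * (β * P₀ ⁻¹))  ≈⟨ solve 4 (λ P v b i → P :* (v :* (b :* i)) := b :* v :* (P :* i)) refl P₀ v β (P₀ ⁻¹) ⟩
        β * v * (P₀ * P₀ ⁻¹)    ≈⟨ *-congˡ (x*x⁻¹≈1 P₀≉0) ⟩
        β * v * 1#              ≈⟨ *-identityʳ _ ⟩
        β * v                   ∎)

    root-count-bound : ∀ {xs} → Unique xs → All Root xs → length xs ℕ.≤ suc q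
    root-count-bound xs! xs-roots = monic-roots (monic-+ (monic-^ (suc q)) affine (s≤s (ℕ.<⇒≤ 2≤q))) xs! (All.map x≈y⇒x+y≈0 xs-roots)
      where
      affine : Poly 1 (λ y → α * y + β)
      affine = horner β (λ _ → α) (poly-constant α) (λ y → trans (+-comm _ β) (+-congˡ (*-comm α y)))

    module Roots {x₀ v : Carrier} (x₀-root : Root x₀) (v≉0 : v ≉ 0#) (x₀x₁σv≈βv : x₀ * σ x₀ * σ v ≈ β * v) where
      x₀≉0 : x₀ ≉ 0#
      x₀≉0 = root-nonzero x₀-root

      solution-nonzero : ∀ {z} → σ z + z ≈ v → z ≉ 0#
      solution-nonzero {z} σz+z≈v z≈0 = v≉0 (begin
        v            ≈⟨ σz+z≈v ⟨
        σ z + z      ≈⟨ +-cong (trans (σ-cong z≈0) σ-0) z≈0 ⟩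
        0# + 0#      ≈⟨ +-identityˡ 0# ⟩
        0#           ∎)

      toRoot : Carrier → Carrier
      toRoot z = x₀ * (1# + v * z ⁻¹)

      toRoot-root : ∀ {z} → σ z + z ≈ v → Root (toRoot z)
      toRoot-root {z} σz+z≈v = x*z≈x₀*σz⇒root x₀-root x₀x₁σv≈βv z≉0 σz+z≈v (begin
        x₀ * (1# + v * z ⁻¹) * z
          ≈⟨ solve 4 (λ x₀ v z i → x₀ :* (con 1 :+ v :* i) :* z := x₀ :* (z :+ v :* (z :* i))) refl x₀ v z (z ⁻¹) ⟩
        x₀ * (z + v * (z * z ⁻¹))
          ≈⟨ *-congˡ (+-congˡ (trans (*-congˡ (x*x⁻¹≈1 z≉0)) (*-identityʳ v))) ⟩
        x₀ * (z + v)
          ≈⟨ *-congˡ (x+y≈z⇒x+z≈y (trans (+-comm z (σ z)) σz+z≈v)) ⟩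
        x₀ * σ z ∎)
        where z≉0 = solution-nonzero σz+z≈v

      toRoot-injective : ∀ {y z} → toRoot y ≈ toRoot z → y ≈ z
      toRoot-injective {y} {z} toRoot[y]≈toRoot[z] =
        ⁻¹-injective (*-cancelˡ-nonzero v≉0 (+-cancelˡ 1# _ _ (*-cancelˡ-nonzero x₀≉0 toRoot[y]≈toRoot[z])))

      x₀≉toRoot : ∀ {z} → z ≉ 0# → x₀ ≉ toRoot z
      x₀≉toRoot {z} z≉0 x₀≈toRoot[z] = *-nonzero v≉0 (x*y≈1⇒y≉0 (x*x⁻¹≈1 z≉0))
        (+-cancelˡ 1# _ _ (*-cancelˡ-nonzero x₀≉0 (trans (sym x₀≈toRoot[z]) (sym (trans (*-congˡ (+-identityʳ 1#)) (*-identityʳ x₀))))))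

      solutions : List Carrier
      solutions = fibre (λ z → σ z + z) v elements

      solutions-satisfy : All (λ z → σ z + z ≈ v) solutions
      solutions-satisfy = Allₚ.all-filter (λ z → σ z + z ≟ v) elements

      roots : List Carrier
      roots = x₀ ∷ map toRoot solutions

      roots-unique : Unique roots
      roots-unique = Allₚ.map⁺ (All.map (λ σz+z≈v → x₀≉toRoot (solution-nonzero σz+z≈v)) solutions-satisfy)
                   ∷ Unique.map⁺ setoid setoid toRoot-injective (Unique.filter⁺ setoid (λ z → σ z + z ≟ v) elements-unique)

      roots-are-roots : All Root roots
      roots-are-roots = x₀-root ∷ Allₚ.map⁺ (All.map toRoot-root solutions-satisfy)

      1+q≤length-roots : suc q ℕ.≤ length roots
      1+q≤length-roots = s≤s (ℕ.≤-trans (artin-schreier-fibre (trace-zero x₀-root x₀x₁σv≈βv))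
                                         (ℕ.≤-reflexive (≡.sym (length-map toRoot solutions))))

      roots-complete : ∀ y → Root y → y ∈ roots
      roots-complete y y-root = decidable-stable (Any.any? (y ≟_) roots) y∈roots-irrefutable
        where
        y∈roots-irrefutable : ¬ ¬ (y ∈ roots)
        y∈roots-irrefutable y∉roots = ℕ.<-irrefl ≡.refl (ℕ.<-≤-trans (s≤s 1+q≤length-roots)
          (root-count-bound (Allₚ.¬Any⇒All¬ roots y∉roots ∷ roots-unique) (y-root ∷ roots-are-roots)))

      length-roots : length roots ≡ suc q
      length-roots = ℕ.≤-antisym (root-count-bound roots-unique roots-are-roots) 1+q≤length-roots

    x^[q+1]+αx+β≈xσx+[αx+β] : ∀ y → (pow E y (q ℕ.+ 1) + α * y) + β ≈ y * σ y + (α * y + β)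
    x^[q+1]+αx+β≈xσx+[αx+β] y = begin
      pow E y (q ℕ.+ 1) + α * y + β      ≡⟨ ≡.cong (λ t → t + α * y + β) (pow≡^ y (q ℕ.+ 1)) ⟩
      y ^ (q ℕ.+ 1) + α * y + β          ≈⟨ +-congʳ (+-congʳ (x^[q+1]≈x*σx y)) ⟩
      y * σ y + α * y + β                ≈⟨ +-assoc _ _ _ ⟩
      y * σ y + (α * y + β)              ∎

    root⇒RootInP : ∀ {y} → Root y → RootInP E q α β y
    root⇒RootInP {y} y-root = ≡.subst (_≈ 1#) (≡.sym (pow≡^ y K)) (trans (x^K≈norm y) (root-norm y-root))
                            , trans (x^[q+1]+αx+β≈xσx+[αx+β] y) (x≈y⇒x+y≈0 y-root)

    count-roots : ∀ {x₀ v} → Root x₀ → v ≉ 0# → x₀ * σ x₀ * σ v ≈ β * v → HasExactly E (RootInP E q α β) (q ℕ.+ 1)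
    count-roots x₀-root v≉0 x₀x₁σv≈βv =
      roots , ≡.trans length-roots (ℕ.+-comm 1 q) , roots-unique , All.map root⇒RootInP roots-are-roots ,
      λ y y∈P → roots-complete y (x+y≈0⇒x≈y (trans (sym (x^[q+1]+αx+β≈xσx+[αx+β] y)) (proj₂ y∈P)))
      where open Roots x₀-root v≉0 x₀x₁σv≈βv

    q+1-roots : HasExactly E (RootInP E q α β) (q ℕ.+ 1)
    q+1-roots =
      let x₀ , x₀-root = root-exists
          v , v≉0 , x₀x₁σv≈βv = x₀x₁σv≈βv-solvable x₀-root
      in count-roots x₀-root v≉0 x₀x₁σv≈βv

open import Data.Nat using (_≥_; _+_; _^_)

lemma2p3 : ∀ {c ℓ} (m : ℕ) → m ≥ 1 →
    (E : CommutativeRing c ℓ) → IsField E → HasCard E ((2 ^ m) ^ 4) →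
    (α β : CommutativeRing.Carrier E) → InP E (2 ^ m) β →
    AlphaBeta E (2 ^ m) α β →
    HasExactly E (RootInP E (2 ^ m) α β) (2 ^ m + 1)
lemma2p3 (suc k) _ E isField card α β β∈P αβ = QuarticExtension.Equation.q+1-roots E isField k card α β β∈P αβ
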